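{- Let $E$ be a set with $|E|=n$ and $0\le r\le n$, let $\mathrm{U}(r,n)$ be the uniform matroid on $E$, and let $p$ be a prime. Then the monoid $\mathcal{Q}_p(\mathrm{U}(r,n))$ is isomorphic to the monoid (under pointwise addition) of monotone functions $2^E\to\mathbb{N}$, where $2^E$ is partially ordered by the reflexive–transitive closure of the directed graph $G_{\mathrm{U}(r,n)}$.
   Context: $\mathrm{U}(r,n)$ has rank function $\operatorname{rk}(A)=\min(|A|,r)$. A multiplicity function on a matroid $(E,\operatorname{rk})$ is $m:2^E\to\mathbb{Z}_{>0}$ satisfying (A1): for all $A\subseteq E$, $e\in E$, if $\operatorname{rk}(A\cup\{e\})>\operatorname{rk}(A)$ then $m(A)\mid m(A\cup\{e\})$, and if $\operatorname{rk}(A\cup\{e\})=\operatorname{rk}(A)$ then $m(A\cup\{e\})\mid m(A)$; and (A2): for every molecule $(R,F,T)$ (pairwise disjoint subsets with $\operatorname{rk}(A)=\operatorname{rk}(R)+|A\cap F|$ for all $R\subseteq A\subseteq R\cup F\cup T$), $m(R)m(R\cup F\cup T)=m(R\cup F)m(R\cup T)$. $\mathcal{Q}_p(M)=\{v_p\circ m\mid m \text{ a multiplicity function on } M\}$, where $v_p(k)$ is the exponent of $p$ in $k$; it is an additive submonoid of $\mathbb{N}^{2^E}$. The directed graph $G_M$ has vertex set $2^E$, and for $A\subseteq E$, $e\notin A$: an edge from $A$ to $A\cup\{e\}$ if $\operatorname{rk}(A)<\operatorname{rk}(A\cup\{e\})$, and otherwise an edge from $A\cup\{e\}$ to $A$;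 it is acyclic. A function $f$ is monotone if $A\le B\Rightarrow f(A)\le f(B)$. -}

module Defs where

open import Data.Nat using (ℕ; zero; suc; _+_; _*_; _^_; _≤_; _<_; _⊓_)
open import Data.Nat.Divisibility using (_∣_)
open import Data.Fin using (Fin)
open import Data.Fin.Subset using (Subset; _∈_; _∉_; _⊆_; _∪_; _∩_; ⁅_⁆; ∣_∣)
open import Data.Product using (Σ; ∃; _×_; _,_; proj₁)
open import Data.Sum using (_⊎_)
open import Relation.Nullary using (¬_)
open import Relation.Binary.PropositionalEquality using (_≡_)
open import Relation.Binary.Construct.Closure.ReflexiveTransitive using (Star)

RankFn : ℕ → Set
RankFn n = Subset n → ℕ

uniformRank : (r n : ℕ) → RankFn n
uniformRank r n A = ∣ A ∣ ⊓ r

Disjoint : ∀ {n} → Subset n → Subset n → Set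
Disjoint A B = ∀ x → x ∈ A → x ∉ B

IsMolecule : ∀ {n} → RankFn n → Subset n → Subset n → Subset n → Set
IsMolecule rk R F T =
  Disjoint R F × Disjoint R T × Disjoint F T ×
  (∀ A → R ⊆ A → A ⊆ (R ∪ F ∪ T) → rk A ≡ rk R + ∣ A ∩ F ∣)

record IsMultiplicity {n} (rk : RankFn n) (m : Subset n → ℕ) : Set where
  field
    positive : ∀ A → 1 ≤ m A
    A1-up    : ∀ A e → rk A < rk (A ∪ ⁅ e ⁆) → m A ∣ m (A ∪ ⁅ e ⁆)
    A1-down  : ∀ A e → rk (A ∪ ⁅ e ⁆) ≡ rk A → m (A ∪ ⁅ e ⁆) ∣ m A
    A2       : ∀ R F T → IsMolecule rk R F T →
               m R * m (R ∪ F ∪ T) ≡ m (R ∪ F) * m (R ∪ T)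

IsValuation : ℕ → ℕ → ℕ → Set
IsValuation p k v = (p ^ v ∣ k) × ¬ (p ^ suc v ∣ k)

InQ : ∀ {n} → ℕ → RankFn n → (Subset n → ℕ) → Set
InQ {n} p rk f = Σ (Subset n → ℕ) λ m → IsMultiplicity rk m × (∀ A → IsValuation p (m A) (f A))

data Edge {n} (rk : RankFn n) : Subset n → Subset n → Set where
  up   : ∀ A e → e ∉ A → rk A < rk (A ∪ ⁅ e ⁆) → Edge rk A (A ∪ ⁅ e ⁆)
  down : ∀ A e → e ∉ A → ¬ (rk A < rk (A ∪ ⁅ e ⁆)) → Edge rk (A ∪ ⁅ e ⁆) A

_≤[_]_ : ∀ {n} → Subset n → RankFn n → Subset n → Set
A ≤[ rk ] B = Star (Edge rk) A B

Monotone : ∀ {n} → RankFn n → (Subset n → ℕ) → Set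
Monotone rk f = ∀ A B → A ≤[ rk ] B → f A ≤ f B

QpCarrier : ∀ {n} → ℕ → RankFn n → Set
QpCarrier {n} p rk = Σ (Subset n → ℕ) (InQ p rk)

MonoCarrier : ∀ {n} → RankFn n → Set
MonoCarrier {n} rk = Σ (Subset n → ℕ) (Monotone rk)

_≐_ : ∀ {n} → (Subset n → ℕ) → (Subset n → ℕ) → Set
f ≐ g = ∀ A → f A ≡ g A

-- An isomorphism of submonoids X, Y of (2^E → ℕ, pointwise +, 0), whose
-- elements are functions paired with membership proofs, compared pointwise.
record MonoidIso {n} (P Q : (Subset n → ℕ) → Set) : Set where
  field
    to      : Σ (Subset n → ℕ) P → Σ (Subset n → ℕ) Q
    from    : Σ (Subset n → ℕ) Q → Σ (Subset n → ℕ) P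
    to-cong   : ∀ x y → proj₁ x ≐ proj₁ y → proj₁ (to x) ≐ proj₁ (to y)
    from-cong : ∀ x y → proj₁ x ≐ proj₁ y → proj₁ (from x) ≐ proj₁ (from y)
    to-from : ∀ y → proj₁ (to (from y)) ≐ proj₁ y
    from-to : ∀ x → proj₁ (from (to x)) ≐ proj₁ x
    to-+    : ∀ x y z → proj₁ z ≐ (λ A → proj₁ x A + proj₁ y A) →
              proj₁ (to z) ≐ (λ A → proj₁ (to x) A + proj₁ (to y) A)
    to-0    : ∀ z → proj₁ z ≐ (λ _ → 0) → proj₁ (to z) ≐ (λ _ → 0)

-- In U(r,n) every molecule (R,F,T) has F = ∅ or T = ∅: if x ∈ F then
-- rk R < rk (R ∪ F) ≤ r, so R is independent and rk (R ∪ T) > rk R unless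
-- T = ∅, while the molecule condition forces rk (R ∪ T) = rk R. Hence (A2)
-- is vacuous, and m ↦ v_p ∘ m, f ↦ p^f are mutually inverse: (A1) for a
-- multiplicity says exactly that v_p ∘ m increases along the edges of G_M,
-- and p^f satisfies (A1) for every monotone f.
module Submission where

open import Defs
open import Data.Nat using (ℕ; _≤_)
open import Data.Nat.Primality using (Prime)

open import Data.Nat using (suc; _+_; _*_; _∸_; _^_; _<_; _⊓_; NonZero; nonTrivial⇒n>1)
open import Data.Nat.Properties
open import Data.Nat.Divisibility using (_∣_; m∣m*n; ∣-trans; ∣-refl; >⇒∤)
open import Data.Nat.Primality using (prime⇒nonTrivial)
open import Data.Fin.Subset using (Subset; _∈_; _⊆_; _∪_; _∩_; ⁅_⁆; ∣_∣; ⊥)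
open import Data.Fin.Subset.Properties
open import Data.Product using (_,_)
open import Data.Sum using (_⊎_; inj₁; inj₂; [_,_])
open import Data.Empty using (⊥-elim)
open import Relation.Nullary using (yes; no; contradiction)
open import Relation.Binary.PropositionalEquality using (_≡_; refl; sym; trans; cong; subst; module ≡-Reasoning)
open import Relation.Binary.Construct.Closure.ReflexiveTransitive using (ε; _◅_)

module _ {n : ℕ} where

  x∈p⇒⁅x⁆⊆p : ∀ {x} {p : Subset n} → x ∈ p → ⁅ x ⁆ ⊆ p
  x∈p⇒⁅x⁆⊆p {x} {p} x∈p y∈⁅x⁆ = subst (_∈ p) (sym (x∈⁅y⁆⇒x≡y x y∈⁅x⁆)) x∈p

  x∈p⇒p∪⁅x⁆≡p : ∀ {x} {p : Subset n} → x ∈ p → p ∪ ⁅ x ⁆ ≡ p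
  x∈p⇒p∪⁅x⁆≡p {x} {p} x∈p = ⊆-antisym
    (λ y∈ → [ (λ y∈p → y∈p) , x∈p⇒⁅x⁆⊆p x∈p ] (x∈p∪q⁻ p ⁅ x ⁆ y∈))
    (p⊆p∪q ⁅ x ⁆)

  x∈p⇒0<∣p∣ : ∀ {x} {p : Subset n} → x ∈ p → 0 < ∣ p ∣
  x∈p⇒0<∣p∣ {x} x∈p = subst (_≤ _) (∣⁅x⁆∣≡1 x) (p⊆q⇒∣p∣≤∣q∣ (x∈p⇒⁅x⁆⊆p x∈p))

  ∪-monoʳ-⊆ : ∀ (p : Subset n) {q q′} → q ⊆ q′ → p ∪ q ⊆ p ∪ q′
  ∪-monoʳ-⊆ p q⊆q′ x∈ = [ (λ x∈p → x∈p∪q⁺ (inj₁ x∈p)) , (λ x∈q → x∈p∪q⁺ (inj₂ (q⊆q′ x∈q))) ]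
                          (x∈p∪q⁻ p _ x∈)

  Disjoint-∪ˡ : ∀ {p q r : Subset n} → Disjoint p r → Disjoint q r → Disjoint (p ∪ q) r
  Disjoint-∪ˡ {p} {q} p#r q#r x x∈ = [ p#r x , q#r x ] (x∈p∪q⁻ p q x∈)

  Disjoint⇒∩≡⊥ : ∀ {p q : Subset n} → Disjoint p q → p ∩ q ≡ ⊥
  Disjoint⇒∩≡⊥ {p} {q} p#q = Empty-unique λ { (x , x∈) →
    let (x∈p , x∈q) = x∈p∩q⁻ p q x∈ in p#q x x∈p x∈q }

m⊓o<n⊓o∧m<k⇒m⊓o<k⊓o : ∀ {m n k} o → m ⊓ o < n ⊓ o → m < k → m ⊓ o < k ⊓ o
m⊓o<n⊓o∧m<k⇒m⊓o<k⊓o {m} {n} {k} o m⊓o<n⊓o m<k with ≤-total o m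
... | inj₁ o≤m = ⊥-elim (<-irrefl refl (subst (_< o) (m≥n⇒m⊓n≡n o≤m) (m<n⊓o⇒m<o n o m⊓o<n⊓o)))
... | inj₂ m≤o = subst (_< k ⊓ o) (sym (m≤n⇒m⊓n≡m m≤o))
                   (⊓-pres-m< m<k (m<n⊓o⇒m<o n o (subst (_< n ⊓ o) (m≤n⇒m⊓n≡m m≤o) m⊓o<n⊓o)))

uniformRank-mono-∪ : ∀ r {n} (A B : Subset n) → uniformRank r n A ≤ uniformRank r n (A ∪ B)
uniformRank-mono-∪ r A B = ⊓-monoˡ-≤ r (∣p∣≤∣p∪q∣ A B)

uniformRank-molecule-degenerate : ∀ r {n} {R F T : Subset n} →
  IsMolecule (uniformRank r n) R F T → F ≡ ⊥ ⊎ T ≡ ⊥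
uniformRank-molecule-degenerate r {n} {R} {F} {T} (R#F , R#T , F#T , rank-eq)
  with nonempty? F | nonempty? T
... | no F-empty | _          = inj₁ (Empty-unique F-empty)
... | yes _      | no T-empty = inj₂ (Empty-unique T-empty)
... | yes (x , x∈F) | yes (y , y∈T) = ⊥-elim (<-irrefl (sym rk[R∪T]≡rkR) rkR<rk[R∪T])
  where
  rk = uniformRank r n

  rkR<rk[R∪F] : rk R < rk (R ∪ F)
  rkR<rk[R∪F] = subst (rk R <_) (sym (rank-eq (R ∪ F) (p⊆p∪q F) (∪-monoʳ-⊆ R (p⊆p∪q T))))
    (m<m+n (rk R) (x∈p⇒0<∣p∣ (x∈p∩q⁺ (q⊆p∪q R F x∈F , x∈F))))

  rk[R∪T]≡rkR : rk (R ∪ T) ≡ rk R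
  rk[R∪T]≡rkR = begin
    rk (R ∪ T)              ≡⟨ rank-eq (R ∪ T) (p⊆p∪q T) (∪-monoʳ-⊆ R (q⊆p∪q F T)) ⟩
    rk R + ∣ (R ∪ T) ∩ F ∣  ≡⟨ cong (λ S → rk R + ∣ S ∣) (Disjoint⇒∩≡⊥ (Disjoint-∪ˡ R#F T#F)) ⟩
    rk R + ∣ ⊥ {n} ∣        ≡⟨ cong (rk R +_) (∣⊥∣≡0 n) ⟩
    rk R + 0                ≡⟨ +-identityʳ (rk R) ⟩
    rk R                    ∎
    where
    open ≡-Reasoning
    T#F : Disjoint T F
    T#F z z∈T z∈F = F#T z z∈F z∈T

  rkR<rk[R∪T] : rk R < rk (R ∪ T)
  rkR<rk[R∪T] = m⊓o<n⊓o∧m<k⇒m⊓o<k⊓o r rkR<rk[R∪F]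
    (p⊂q⇒∣p∣<∣q∣ (p⊆p∪q T , y , q⊆p∪q R T y∈T , λ y∈R → R#T y y∈R y∈T))

^-monoʳ-∣ : ∀ p {a b} → a ≤ b → p ^ a ∣ p ^ b
^-monoʳ-∣ p {a} {b} a≤b = subst (p ^ a ∣_) p^a*p^[b∸a]≡p^b (m∣m*n (p ^ (b ∸ a)))
  where
  p^a*p^[b∸a]≡p^b : p ^ a * p ^ (b ∸ a) ≡ p ^ b
  p^a*p^[b∸a]≡p^b = trans (sym (^-distribˡ-+-* p a (b ∸ a))) (cong (p ^_) (m+[n∸m]≡n a≤b))

isValuation-^ : ∀ {p} → 1 < p → ∀ k → IsValuation p (p ^ k) k
isValuation-^ {p@(suc _)} 1<p k = ∣-refl , >⇒∤ {{m^n≢0 p k}} (^-monoʳ-< p 1<p (n<1+n k))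

isValuation-∣⇒≤ : ∀ {p a b u v} → IsValuation p a u → IsValuation p b v → a ∣ b → u ≤ v
isValuation-∣⇒≤ {p} {u = u} {v} (p^u∣a , _) (_ , p^1+v∤b) a∣b with u ≤? v
... | yes u≤v = u≤v
... | no u≰v = contradiction (∣-trans (^-monoʳ-∣ p (≰⇒> u≰v)) (∣-trans p^u∣a a∣b)) p^1+v∤b

module _ {n} {rk : RankFn n} where

  Edge-≤⇒Monotone : ∀ {f} → (∀ {A B} → Edge rk A B → f A ≤ f B) → Monotone rk f
  Edge-≤⇒Monotone edge-≤ A .A ε              = ≤-refl
  Edge-≤⇒Monotone edge-≤ A B  (edge ◅ path) = ≤-trans (edge-≤ edge) (Edge-≤⇒Monotone edge-≤ _ B path)

  InQ⇒Monotone : (∀ A B → rk A ≤ rk (A ∪ B)) → ∀ {p f} → InQ p rk f → Monotone rk f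
  InQ⇒Monotone rk-mono {f = f} (m , isMultiplicity , val) = Edge-≤⇒Monotone edge-≤
    where
    open IsMultiplicity isMultiplicity
    edge-≤ : ∀ {A B} → Edge rk A B → f A ≤ f B
    edge-≤ (up A e _ rk<) = isValuation-∣⇒≤ (val A) (val _) (A1-up A e rk<)
    edge-≤ (down A e _ rk≮) =
      isValuation-∣⇒≤ (val _) (val A) (A1-down A e (≤-antisym (≮⇒≥ rk≮) (rk-mono A ⁅ e ⁆)))

  degenerate-molecule-identity : ∀ (m : Subset n → ℕ) {R F T} → F ≡ ⊥ ⊎ T ≡ ⊥ →
    m R * m (R ∪ F ∪ T) ≡ m (R ∪ F) * m (R ∪ T)
  degenerate-molecule-identity m {R} {T = T} (inj₁ refl)
    rewrite ∪-identityˡ T | ∪-identityʳ R = refl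
  degenerate-molecule-identity m {R} {F} (inj₂ refl)
    rewrite ∪-identityʳ F | ∪-identityʳ R = *-comm (m R) (m (R ∪ F))

  ^-isMultiplicity : ∀ p .{{_ : NonZero p}} →
    (∀ {R F T} → IsMolecule rk R F T → F ≡ ⊥ ⊎ T ≡ ⊥) →
    ∀ {f} → Monotone rk f → IsMultiplicity rk (λ A → p ^ f A)
  ^-isMultiplicity p degenerate {f} mono = record
    { positive = λ A → m^n>0 p (f A)
    ; A1-up    = A1-up
    ; A1-down  = A1-down
    ; A2       = λ R F T molecule → degenerate-molecule-identity (λ A → p ^ f A) (degenerate molecule)
    }
    where
    A1-up : ∀ A e → rk A < rk (A ∪ ⁅ e ⁆) → p ^ f A ∣ p ^ f (A ∪ ⁅ e ⁆)
    A1-up A e rk< with e ∈? A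
    ... | yes e∈A = ⊥-elim (<-irrefl (sym (cong rk (x∈p⇒p∪⁅x⁆≡p e∈A))) rk<)
    ... | no  e∉A = ^-monoʳ-∣ p (mono _ _ (up A e e∉A rk< ◅ ε))

    A1-down : ∀ A e → rk (A ∪ ⁅ e ⁆) ≡ rk A → p ^ f (A ∪ ⁅ e ⁆) ∣ p ^ f A
    A1-down A e rk≡ with e ∈? A
    ... | yes e∈A = subst (λ S → p ^ f S ∣ p ^ f A) (sym (x∈p⇒p∪⁅x⁆≡p e∈A)) ∣-refl
    ... | no  e∉A = ^-monoʳ-∣ p (mono _ _ (down A e e∉A (<-irrefl (sym rk≡)) ◅ ε))

  Monotone⇒InQ : ∀ {p} → 1 < p →
    (∀ {R F T} → IsMolecule rk R F T → F ≡ ⊥ ⊎ T ≡ ⊥) →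
    ∀ {f} → Monotone rk f → InQ p rk f
  Monotone⇒InQ {p@(suc _)} 1<p degenerate {f} mono =
    (λ A → p ^ f A) , ^-isMultiplicity p degenerate mono , (λ A → isValuation-^ 1<p (f A))

⊆∧⊇⇒MonoidIso : ∀ {n} {P Q : (Subset n → ℕ) → Set} →
  (∀ {f} → P f → Q f) → (∀ {f} → Q f → P f) → MonoidIso P Q
⊆∧⊇⇒MonoidIso P⊆Q Q⊆P = record
  { to        = λ (f , Pf) → f , P⊆Q Pf
  ; from      = λ (f , Qf) → f , Q⊆P Qf
  ; to-cong   = λ _ _ f≐g → f≐g
  ; from-cong = λ _ _ f≐g → f≐g
  ; to-from   = λ _ _ → refl
  ; from-to   = λ _ _ → refl
  ; to-+      = λ _ _ _ h≐f+g → h≐f+g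
  ; to-0      = λ _ h≐0 → h≐0
  }

proposition27 : (n r : ℕ) → r ≤ n → (p : ℕ) → Prime p →
    MonoidIso {n} (InQ p (uniformRank r n)) (Monotone (uniformRank r n))
proposition27 n r _ p p-prime = ⊆∧⊇⇒MonoidIso
  (InQ⇒Monotone (uniformRank-mono-∪ r))
  (Monotone⇒InQ (nonTrivial⇒n>1 p {{prime⇒nonTrivial p-prime}}) (uniformRank-molecule-degenerate r))
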